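{- Let $(A_n)_{n\geq 1}$ be a sequence of nonempty finite subsets of $\mathbb{N}^*$ with $A_n<A_{n+1}$ for all $n\geq 1$. Then the infinite word $Y=\prod_{n\geq 1}u_{A_n}$ is a suffix of the Zimin word $Z$ if and only if there exists $N$ such that for all $n\geq N$, $A_n$ is an interval and $\min A_{n+1}=1+\max A_n$.
   Context: Alphabet $\{x_1,x_2,\ldots\}$; $Z_1=x_1$, $Z_{m+1}=Z_mx_{m+1}Z_m$, $Z=\lim Z_m$. $u_1=x_1$, $u_{m+1}=x_{m+1}u_1u_2\cdots u_m$; for finite $A=\{i_1<\cdots<i_k\}$, $u_A=u_{i_1}\cdots u_{i_k}$. For finite sets, $A<B$ means $\max A<\min B$. An interval is a set $\{k,k+1,\ldots,l\}$ of integers. A suffix of $Z=z_0z_1\ldots$ is $z_kz_{k+1}\ldots$ for some $k\geq0$. -}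

module Defs where

open import Data.Nat using (ℕ; zero; suc; _+_; _≤_; _<_; _⊔_; _⊓_)
open import Data.List using (List; []; _∷_; _++_; concat; map; foldr; upTo; [_])
open import Data.List.Membership.Propositional using (_∈_)
open import Data.Product using (_×_; ∃; ∃₂)
open import Function.Bundles using (_⇔_)
open import Relation.Binary.PropositionalEquality using (_≡_)

-- letters x_i are represented by the natural number i (i ≥ 1)

-- nth element of a list, with default 0 (only used where the index is in range)
nth : List ℕ → ℕ → ℕ
nth []       _       = 0
nth (x ∷ xs) zero    = x
nth (x ∷ xs) (suc k) = nth xs k

-- Zimin words: Zw m = Z_{m+1};  Z_1 = x_1,  Z_{m+1} = Z_m x_{m+1} Z_m
Zw : ℕ → List ℕ
Zw zero    = [ 1 ]
Zw (suc m) = Zw m ++ (suc (suc m) ∷ Zw m)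

-- the infinite Zimin word Z = lim Z_m, as a function from positions (0-based) to letters;
-- Z_{k+1} has length 2^{k+1}-1 > k, and all Z_m are prefixes of each other
Z : ℕ → ℕ
Z k = nth (Zw k) k

-- us m = [u_1, ..., u_m],  u_1 = x_1, u_{m+1} = x_{m+1} u_1 ... u_m
us : ℕ → List (List ℕ)
us zero    = []
us (suc m) = us m ++ [ suc m ∷ concat (us m) ]

lastL : List (List ℕ) → List ℕ
lastL []           = []
lastL (x ∷ [])     = x
lastL (x ∷ y ∷ ys) = lastL (y ∷ ys)

u : ℕ → List ℕ
u i = lastL (us i)

-- a finite set A = {i_1 < ... < i_k} is represented by its increasing list;
-- u_A = u_{i_1} ... u_{i_k}
uA : List ℕ → List ℕ
uA A = concat (map u A)

-- prefix u_{A_0} ... u_{A_{n-1}} of Y (sequence indexed from 0 here)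
Ypre : (ℕ → List ℕ) → ℕ → List ℕ
Ypre A n = concat (map (λ j → uA (A j)) (upTo n))

-- the infinite word Y = ∏ u_{A_n}, as a function of positions (each block is nonempty,
-- so position i lies within the first i+1 blocks)
Y : (ℕ → List ℕ) → ℕ → ℕ
Y A i = nth (Ypre A (suc i)) i

IsSuffixOfZ : (ℕ → ℕ) → Set
IsSuffixOfZ W = ∃ λ k → ∀ i → W i ≡ Z (k + i)

IsInterval : List ℕ → Set
IsInterval S = ∃₂ λ k l → ∀ x → (x ∈ S) ⇔ (k ≤ x × x ≤ l)

maxL : List ℕ → ℕ
maxL = foldr _⊔_ 0

minL : List ℕ → ℕ
minL []       = 0
minL (x ∷ xs) = foldr _⊓_ x xs

-- Write Z_m = u_1 ⋯ u_m, so that Z_{m+1} = Z_m u_{m+1} = Z_m x_{m+1} Z_m.  The letter x_{m+1}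
-- first occurs in Z at position |Z_m|, and every earlier letter is smaller.  In a product u_A
-- such a record letter can only be the head x_i of some factor u_i = x_i Z_{i-1}, since all
-- letters of Z_{i-1} are below x_i.  So if Y is a suffix of Z, every large index occurs in
-- some A_n, which forces the A_n to be eventually consecutive intervals.  Conversely, if
-- u_{A_1} ⋯ u_{A_n} is a suffix of Z_{max A_n}, then appending the block of an interval
-- A_{n+1} starting at 1 + max A_n gives exactly Z_{max A_{n+1}}, so from some point on the
-- prefixes of Y are the prefixes of Z shifted by a fixed amount.
module Submission where

open import Defs
open import Data.Nat using (ℕ; zero; suc; _+_; _∸_; _≤_; _<_; _⊓_; z≤n; s≤s; _≤?_; _<?_)
open import Data.Nat.Properties
open import Data.List using (List; []; _∷_; _++_; concat; map; foldr; upTo; [_]; length)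
open import Data.List.Properties using (++-assoc; ++-identityʳ; length-++; map-++; concat-++; upTo-∷ʳ)
open import Data.List.Membership.Propositional using (_∈_)
open import Data.List.Membership.Propositional.Properties using (∈-concat⁻′; ∈-map⁻)
open import Data.List.Relation.Unary.All as All using (All; []; _∷_)
open import Data.List.Relation.Unary.All.Properties using (++⁺)
open import Data.List.Relation.Unary.Any using (here; there)
open import Data.List.Relation.Unary.AllPairs using (AllPairs; []; _∷_)
open import Data.List.Relation.Unary.Linked using (Linked)
open import Data.List.Relation.Unary.Linked.Properties using (Linked⇒AllPairs)
open import Data.Product using (_×_; _,_; ∃; ∃-syntax; proj₁; proj₂)
open import Data.Sum using (inj₁; inj₂)
open import Data.Empty using (⊥; ⊥-elim)
open import Function.Bundles using (_⇔_; mk⇔; Equivalence)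
open import Relation.Binary.Definitions using (Reflexive; Transitive; tri<; tri≈; tri>)
open import Relation.Binary.PropositionalEquality using (_≡_; _≢_; refl; sym; trans; cong; cong₂; subst; module ≡-Reasoning)
open import Relation.Nullary using (yes; no)

open Equivalence using (to; from)

stepwise⇒monotone : ∀ {a r} {X : Set a} (R : X → X → Set r) → Reflexive R → Transitive R →
                    (F : ℕ → X) → (∀ n → R (F n) (F (suc n))) → ∀ {m n} → m ≤ n → R (F m) (F n)
stepwise⇒monotone R R-refl R-trans F step {n = zero} z≤n = R-refl
stepwise⇒monotone R R-refl R-trans F step {m} {suc n} m≤1+n with m≤n⇒m<n∨m≡n m≤1+n
... | inj₂ refl = R-refl
... | inj₁ (s≤s m≤n) = R-trans (stepwise⇒monotone R R-refl R-trans F step m≤n) (step n)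

_IsPrefixOf_ : List ℕ → List ℕ → Set
xs IsPrefixOf ys = ∃ λ r → ys ≡ xs ++ r

_IsSuffixOf_ : List ℕ → List ℕ → Set
xs IsSuffixOf ys = ∃ λ r → ys ≡ r ++ xs

IsPrefixOf-refl : Reflexive _IsPrefixOf_
IsPrefixOf-refl = [] , sym (++-identityʳ _)

IsPrefixOf-trans : Transitive _IsPrefixOf_
IsPrefixOf-trans {xs} (r , refl) (r′ , refl) = r ++ r′ , ++-assoc xs r r′

IsSuffixOf-refl : Reflexive _IsSuffixOf_
IsSuffixOf-refl = [] , refl

IsSuffixOf-trans : Transitive _IsSuffixOf_
IsSuffixOf-trans {xs} (r , refl) (r′ , refl) = r′ ++ r , sym (++-assoc r′ r xs)

IsSuffixOf-++ : ∀ {xs ys} zs → xs IsSuffixOf ys → (xs ++ zs) IsSuffixOf (ys ++ zs)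
IsSuffixOf-++ {xs} zs (r , refl) = r , ++-assoc r xs zs

nth-++ˡ : ∀ xs ys {i} → i < length xs → nth (xs ++ ys) i ≡ nth xs i
nth-++ˡ (x ∷ xs) ys {zero}  _         = refl
nth-++ˡ (x ∷ xs) ys {suc i} (s≤s i<n) = nth-++ˡ xs ys i<n

nth-++ʳ : ∀ xs ys i → nth (xs ++ ys) (length xs + i) ≡ nth ys i
nth-++ʳ []       ys i = refl
nth-++ʳ (x ∷ xs) ys i = nth-++ʳ xs ys i

nth-All : ∀ {P : ℕ → Set} {xs} i → All P xs → i < length xs → P (nth xs i)
nth-All zero    (px ∷ _)   _         = px
nth-All (suc i) (_  ∷ pxs) (s≤s i<n) = nth-All i pxs i<n

nth-prefix : ∀ {xs ys i} → xs IsPrefixOf ys → i < length xs → nth ys i ≡ nth xs i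
nth-prefix {xs} (r , refl) = nth-++ˡ xs r

IsPrefixOf-chain : (F : ℕ → List ℕ) → (∀ n → F n IsPrefixOf F (suc n)) → ∀ {m n} → m ≤ n → F m IsPrefixOf F n
IsPrefixOf-chain = stepwise⇒monotone _IsPrefixOf_ IsPrefixOf-refl IsPrefixOf-trans

nth-stable : (F : ℕ → List ℕ) → (∀ n → F n IsPrefixOf F (suc n)) →
             ∀ m n {i} → i < length (F m) → i < length (F n) → nth (F m) i ≡ nth (F n) i
nth-stable F grows m n i<m i<n with ≤-total m n
... | inj₁ m≤n = sym (nth-prefix (IsPrefixOf-chain F grows m≤n) i<m)
... | inj₂ n≤m = nth-prefix (IsPrefixOf-chain F grows n≤m) i<n

maxL-ub : ∀ {x S} → x ∈ S → x ≤ maxL S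
maxL-ub {S = y ∷ ys} (here refl) = m≤m⊔n y _
maxL-ub {S = y ∷ ys} (there x∈) = ≤-trans (maxL-ub x∈) (m≤n⊔m y _)

maxL-∷-∈ : ∀ y ys → maxL (y ∷ ys) ∈ y ∷ ys
maxL-∷-∈ y []       = here (⊔-identityʳ y)
maxL-∷-∈ y (z ∷ zs) with ⊔-sel y (maxL (z ∷ zs))
... | inj₁ y-wins    = here y-wins
... | inj₂ rest-wins = there (subst (_∈ z ∷ zs) (sym rest-wins) (maxL-∷-∈ z zs))

maxL-∈ : ∀ {S} → S ≢ [] → maxL S ∈ S
maxL-∈ {[]}     S≢[] = ⊥-elim (S≢[] refl)
maxL-∈ {y ∷ ys} _    = maxL-∷-∈ y ys

foldr-⊓-lb : ∀ a xs {x} → x ∈ a ∷ xs → foldr _⊓_ a xs ≤ x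
foldr-⊓-lb a []       (here refl)         = ≤-refl
foldr-⊓-lb a (y ∷ ys) (here refl)         = ≤-trans (m⊓n≤n y _) (foldr-⊓-lb a ys (here refl))
foldr-⊓-lb a (y ∷ ys) (there (here refl)) = m⊓n≤m y _
foldr-⊓-lb a (y ∷ ys) (there (there x∈))  = ≤-trans (m⊓n≤n y _) (foldr-⊓-lb a ys (there x∈))

foldr-⊓-∈ : ∀ a xs → foldr _⊓_ a xs ∈ a ∷ xs
foldr-⊓-∈ a []       = here refl
foldr-⊓-∈ a (y ∷ ys) with ⊓-sel y (foldr _⊓_ a ys) | foldr-⊓-∈ a ys
... | inj₁ y-wins    | _          = there (here y-wins)
... | inj₂ rest-wins | here e     = here (trans rest-wins e)
... | inj₂ rest-wins | there min∈ = there (there (subst (_∈ ys) (sym rest-wins) min∈))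

minL-lb : ∀ {x S} → x ∈ S → minL S ≤ x
minL-lb {S = y ∷ ys} = foldr-⊓-lb y ys

minL-∈ : ∀ {S} → S ≢ [] → minL S ∈ S
minL-∈ {[]}     S≢[] = ⊥-elim (S≢[] refl)
minL-∈ {y ∷ ys} _    = foldr-⊓-∈ y ys

minL≤maxL : ∀ {S} → S ≢ [] → minL S ≤ maxL S
minL≤maxL S≢[] = maxL-ub (minL-∈ S≢[])

-- zimin m = u_1 ⋯ u_m = Z_m, with Z_0 empty; so zimin (suc m) ≡ Zw m.
zimin : ℕ → List ℕ
zimin m = concat (us m)

lastL-∷ʳ : ∀ xs (y : List ℕ) → lastL (xs ++ [ y ]) ≡ y
lastL-∷ʳ []           y = refl
lastL-∷ʳ (x ∷ [])     y = refl
lastL-∷ʳ (x ∷ x′ ∷ xs) y = lastL-∷ʳ (x′ ∷ xs) y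

u-suc : ∀ m → u (suc m) ≡ suc m ∷ zimin m
u-suc m = lastL-∷ʳ (us m) _

zimin-suc : ∀ m → zimin (suc m) ≡ zimin m ++ (suc m ∷ zimin m)
zimin-suc m = begin
  concat (us m ++ [ suc m ∷ zimin m ])     ≡⟨ concat-++ (us m) _ ⟨
  zimin m ++ ((suc m ∷ zimin m) ++ [])     ≡⟨ cong (zimin m ++_) (++-identityʳ _) ⟩
  zimin m ++ (suc m ∷ zimin m)             ∎
  where open ≡-Reasoning

zimin-suc-u : ∀ m → zimin (suc m) ≡ zimin m ++ u (suc m)
zimin-suc-u m = trans (zimin-suc m) (cong (zimin m ++_) (sym (u-suc m)))

zimin-Zw : ∀ m → zimin (suc m) ≡ Zw m
zimin-Zw zero    = refl
zimin-Zw (suc m) = trans (zimin-suc (suc m)) (cong (λ w → w ++ (suc (suc m) ∷ w)) (zimin-Zw m))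

zimin-grows : ∀ m → zimin m IsPrefixOf zimin (suc m)
zimin-grows m = u (suc m) , zimin-suc-u m

zimin-shrinks : ∀ m → zimin m IsSuffixOf zimin (suc m)
zimin-shrinks m = zimin m ++ [ suc m ] , trans (zimin-suc m) (sym (++-assoc (zimin m) [ suc m ] (zimin m)))

zimin-suffix : ∀ {b m} → b ≤ m → zimin b IsSuffixOf zimin m
zimin-suffix = stepwise⇒monotone _IsSuffixOf_ IsSuffixOf-refl IsSuffixOf-trans zimin zimin-shrinks

zimin-letters≤ : ∀ m → All (_≤ m) (zimin m)
zimin-letters≤ zero    = []
zimin-letters≤ (suc m) rewrite zimin-suc m =
  ++⁺ (All.map m≤n⇒m≤1+n (zimin-letters≤ m)) (≤-refl ∷ All.map m≤n⇒m≤1+n (zimin-letters≤ m))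

<-length-zimin-suc : ∀ m → length (zimin m) < length (zimin (suc m))
<-length-zimin-suc m =
  subst (length (zimin m) <_) (sym (trans (cong length (zimin-suc m)) (length-++ (zimin m)))) (m≤n+m _ _)

≤-length-zimin : ∀ m → m ≤ length (zimin m)
≤-length-zimin zero    = z≤n
≤-length-zimin (suc m) = ≤-trans (s≤s (≤-length-zimin m)) (<-length-zimin-suc m)

Z-agrees : ∀ m {p} → p < length (zimin m) → Z p ≡ nth (zimin m) p
Z-agrees m {p} p<len = trans (cong (λ w → nth w p) (sym (zimin-Zw p)))
  (nth-stable zimin zimin-grows (suc p) m (≤-length-zimin (suc p)) p<len)

IsRecordAt : (ℕ → ℕ) → ℕ → ℕ → Set
IsRecordAt f p m = f p ≡ m × (∀ q → q < p → f q < m)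

IsRecordAt-agree : ∀ {f g p m} → (∀ q → q ≤ p → f q ≡ g q) → IsRecordAt f p m → IsRecordAt g p m
IsRecordAt-agree f≗g (fp≡m , below) =
  trans (sym (f≗g _ ≤-refl)) fp≡m , λ q q<p → subst (_< _) (f≗g q (<⇒≤ q<p)) (below q q<p)

IsRecordAt-shift : ∀ {f} k {p m} → IsRecordAt f (k + p) m → IsRecordAt (λ i → f (k + i)) p m
IsRecordAt-shift k (fp≡m , below) = fp≡m , λ q q<p → below (k + q) (+-monoʳ-< k q<p)

IsRecordAt-++ʳ : ∀ xs {ys p m} → IsRecordAt (nth (xs ++ ys)) (length xs + p) m → IsRecordAt (nth ys) p m
IsRecordAt-++ʳ xs {ys} isRecord = IsRecordAt-agree (λ q _ → nth-++ʳ xs ys q) (IsRecordAt-shift (length xs) isRecord)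

Z-record : ∀ m → IsRecordAt Z (length (zimin m)) (suc m)
Z-record m = first , below
  where
  L = length (zimin m)
  first : Z L ≡ suc m
  first = begin
    Z L                                              ≡⟨ Z-agrees (suc m) (<-length-zimin-suc m) ⟩
    nth (zimin (suc m)) L                            ≡⟨ cong₂ nth (zimin-suc m) (sym (+-identityʳ L)) ⟩
    nth (zimin m ++ (suc m ∷ zimin m)) (L + 0)       ≡⟨ nth-++ʳ (zimin m) _ 0 ⟩
    suc m                                            ∎
    where open ≡-Reasoning
  below : ∀ q → q < L → Z q < suc m
  below q q<L = s≤s (subst (_≤ m) (sym (Z-agrees m q<L)) (nth-All q (zimin-letters≤ m) q<L))

record-not-inside-u : ∀ {i ys p m} → IsRecordAt (nth ((suc i ∷ zimin i) ++ ys)) (suc p) m →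
                      p < length (zimin i) → ⊥
record-not-inside-u {i} {ys} {p} (e , below) p<L = <⇒≱ (below 0 (s≤s z≤n)) (m≤n⇒m≤1+n m≤i)
  where
  m≤i = subst (_≤ i) (trans (sym (nth-++ˡ (zimin i) ys p<L)) e) (nth-All p (zimin-letters≤ i) p<L)

-- 1 ≤ m rules out the default value 0 of nth past the end; a factor u 0 = [] contributes nothing.
uA-record∈ : ∀ I {p m} → 1 ≤ m → IsRecordAt (nth (uA I)) p m → m ∈ I
uA-record∈ []          1≤m (0≡m , _) = ⊥-elim (<⇒≢ 1≤m 0≡m)
uA-record∈ (zero ∷ I)  1≤m isRecord    = there (uA-record∈ I 1≤m isRecord)
uA-record∈ (suc i ∷ I) {m = m} 1≤m isRecord =
  head-or-later (subst (λ w → IsRecordAt (nth (w ++ uA I)) _ m) (u-suc i) isRecord)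
  where
  head-or-later : ∀ {p} → IsRecordAt (nth ((suc i ∷ zimin i) ++ uA I)) p m → m ∈ suc i ∷ I
  head-or-later {zero}  (e , _) = here (sym e)
  head-or-later {suc p} isRecord with p <? length (zimin i)
  ... | yes p<L = ⊥-elim (record-not-inside-u isRecord p<L)
  ... | no  p≮L = there (uA-record∈ I 1≤m (IsRecordAt-++ʳ (suc i ∷ zimin i)
                    (subst (λ q → IsRecordAt _ (suc q) m) (sym (m+[n∸m]≡n (≮⇒≥ p≮L))) isRecord)))

uA-++ : ∀ xs ys → uA (xs ++ ys) ≡ uA xs ++ uA ys
uA-++ xs ys = trans (cong concat (map-++ u xs ys)) (sym (concat-++ (map u xs) (map u ys)))

concat-map-uA : ∀ (f : ℕ → List ℕ) L → concat (map (λ j → uA (f j)) L) ≡ uA (concat (map f L))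
concat-map-uA f []      = refl
concat-map-uA f (j ∷ L) = trans (cong (uA (f j) ++_) (concat-map-uA f L)) (sym (uA-++ (f j) _))

Ypre-suc : ∀ A n → Ypre A (suc n) ≡ Ypre A n ++ uA (A n)
Ypre-suc A n = begin
  concat (map g (upTo (suc n)))       ≡⟨ cong (λ l → concat (map g l)) (upTo-∷ʳ n) ⟨
  concat (map g (upTo n ++ [ n ]))    ≡⟨ cong concat (map-++ g (upTo n) [ n ]) ⟩
  concat (map g (upTo n) ++ [ g n ])  ≡⟨ concat-++ (map g (upTo n)) _ ⟨
  Ypre A n ++ (g n ++ [])             ≡⟨ cong (Ypre A n ++_) (++-identityʳ (g n)) ⟩
  Ypre A n ++ g n                     ∎
  where open ≡-Reasoning
        g = λ j → uA (A j)

uA-nonempty : ∀ S → S ≢ [] → All (1 ≤_) S → 1 ≤ length (uA S)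
uA-nonempty []          S≢[] _ = ⊥-elim (S≢[] refl)
uA-nonempty (zero ∷ _)  _    (() ∷ _)
uA-nonempty (suc i ∷ S) _    _ rewrite length-++ (u (suc i)) {uA S} | u-suc i = s≤s z≤n

zimin-extend : ∀ {W b m} I → W IsSuffixOf zimin b → All (b <_) I → AllPairs _<_ I → All (_≤ m) I → b ≤ m →
               (W ++ uA I) IsSuffixOf zimin m
zimin-extend {W} [] W⊑ _ _ _ b≤m =
  subst (_IsSuffixOf _) (sym (++-identityʳ W)) (IsSuffixOf-trans W⊑ (zimin-suffix b≤m))
zimin-extend (zero ∷ I) _ (() ∷ _) _ _ _
zimin-extend {W} (suc i ∷ I) W⊑ (s≤s b≤i ∷ _) (i<I ∷ sorted) (i≤m ∷ I≤m) _ =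
  subst (_IsSuffixOf _) (++-assoc W (u (suc i)) (uA I)) (zimin-extend I Wu⊑ i<I sorted I≤m i≤m)
  where
  Wu⊑ : (W ++ u (suc i)) IsSuffixOf zimin (suc i)
  Wu⊑ = subst ((W ++ u (suc i)) IsSuffixOf_) (sym (zimin-suc-u i))
          (IsSuffixOf-++ (u (suc i)) (IsSuffixOf-trans W⊑ (zimin-suffix b≤i)))

segment : ℕ → ℕ → List ℕ
segment a zero    = []
segment a (suc l) = a ∷ segment (suc a) l

zimin-+-segment : ∀ b l → zimin (b + l) ≡ zimin b ++ uA (segment (suc b) l)
zimin-+-segment b zero    = trans (cong zimin (+-identityʳ b)) (sym (++-identityʳ _))
zimin-+-segment b (suc l) = begin
  zimin (b + suc l)                                     ≡⟨ cong zimin (+-suc b l) ⟩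
  zimin (suc b + l)                                     ≡⟨ zimin-+-segment (suc b) l ⟩
  zimin (suc b) ++ uA (segment (suc (suc b)) l)         ≡⟨ cong (_++ uA (segment (suc (suc b)) l)) (zimin-suc-u b) ⟩
  (zimin b ++ u (suc b)) ++ uA (segment (suc (suc b)) l) ≡⟨ ++-assoc (zimin b) _ _ ⟩
  zimin b ++ uA (segment (suc b) (suc l))               ∎
  where open ≡-Reasoning

sorted-interval≡segment : ∀ {S a l} → AllPairs _<_ S → (∀ x → x ∈ S ⇔ (a ≤ x × x ≤ l)) → S ≡ segment a (suc l ∸ a)
sorted-interval≡segment {[]} {a} {l} _ iff with a ≤? l
... | no a≰l = cong (segment a) (sym (m≤n⇒m∸n≡0 (≰⇒> a≰l)))
... | yes a≤l with from (iff a) (≤-refl , a≤l)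
...   | ()
sorted-interval≡segment {x ∷ S} {a} {l} (x<S ∷ sorted) iff with to (iff x) (here refl)
... | a≤x , x≤l with from (iff a) (≤-refl , ≤-trans a≤x x≤l)
...   | there a∈S = ⊥-elim (<⇒≱ (All.lookup x<S a∈S) a≤x)
...   | here refl =
  trans (cong (x ∷_) (sorted-interval≡segment sorted tail-iff)) (cong (segment x) (sym (+-∸-assoc 1 x≤l)))
  where
  drop-head : ∀ {y} → y ∈ x ∷ S → x < y → y ∈ S
  drop-head (here refl) x<x = ⊥-elim (<-irrefl refl x<x)
  drop-head (there y∈S) _   = y∈S
  tail-iff : ∀ y → y ∈ S ⇔ (suc x ≤ y × y ≤ l)
  tail-iff y = mk⇔ (λ y∈S → All.lookup x<S y∈S , proj₂ (to (iff y) (there y∈S)))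
                   (λ (x<y , y≤l) → drop-head (from (iff y) (<⇒≤ x<y , y≤l)) x<y)

interval-bounds : ∀ {S k l} → S ≢ [] → (∀ x → x ∈ S ⇔ (k ≤ x × x ≤ l)) → k ≡ minL S × l ≡ maxL S
interval-bounds S≢[] iff =
  ≤-antisym k≤min (minL-lb (from (iff _) (≤-refl , k≤l))) ,
  ≤-antisym (maxL-ub (from (iff _) (k≤l , ≤-refl))) max≤l
  where
  k≤min = proj₁ (to (iff _) (minL-∈ S≢[]))
  max≤l = proj₂ (to (iff _) (maxL-∈ S≢[]))
  k≤l   = ≤-trans k≤min (≤-trans (minL≤maxL S≢[]) max≤l)

zimin-interval : ∀ {S b} → S ≢ [] → AllPairs _<_ S → IsInterval S → minL S ≡ suc b → zimin (maxL S) ≡ zimin b ++ uA S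
zimin-interval {S} {b} S≢[] sorted (k , l , iff) min≡1+b = begin
  zimin (maxL S)                          ≡⟨ cong zimin l≡max ⟨
  zimin l                                 ≡⟨ cong zimin (m+[n∸m]≡n b≤l) ⟨
  zimin (b + (l ∸ b))                     ≡⟨ zimin-+-segment b (l ∸ b) ⟩
  zimin b ++ uA (segment (suc b) (l ∸ b)) ≡⟨ cong (λ a → zimin b ++ uA (segment a (suc l ∸ a))) k≡1+b ⟨
  zimin b ++ uA (segment k (suc l ∸ k))   ≡⟨ cong (λ T → zimin b ++ uA T) (sorted-interval≡segment sorted iff) ⟨
  zimin b ++ uA S                         ∎
  where
  open ≡-Reasoning
  l≡max = proj₂ (interval-bounds S≢[] iff)
  k≡1+b = trans (proj₁ (interval-bounds S≢[] iff)) min≡1+b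
  k≤l = ≤-trans (proj₁ (to (iff _) (minL-∈ S≢[]))) (proj₂ (to (iff _) (minL-∈ S≢[])))
  b≤l = <⇒≤ (subst (_≤ l) k≡1+b k≤l)

module Blocks (A : ℕ → List ℕ) (nonempty : ∀ n → A n ≢ []) (positive : ∀ n → All (1 ≤_) (A n))
              (ordered : ∀ n x y → x ∈ A n → y ∈ A (suc n) → x < y) where

  ≤-length-Ypre : ∀ n → n ≤ length (Ypre A n)
  ≤-length-Ypre zero    = z≤n
  ≤-length-Ypre (suc n) rewrite Ypre-suc A n | length-++ (Ypre A n) {uA (A n)} =
    subst (_≤ length (Ypre A n) + length (uA (A n))) (+-comm n 1)
      (+-mono-≤ (≤-length-Ypre n) (uA-nonempty (A n) (nonempty n) (positive n)))

  Y-agrees : ∀ n {i} → i < length (Ypre A n) → Y A i ≡ nth (Ypre A n) i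
  Y-agrees n {i} i<len = nth-stable (Ypre A) (λ m → uA (A m) , Ypre-suc A m) (suc i) n (≤-length-Ypre _) i<len

  Y-record∈block : ∀ {p m} → 1 ≤ m → IsRecordAt (Y A) p m → ∃[ n ] m ∈ A n
  Y-record∈block {p} {m} 1≤m isRecord =
    let (S , m∈S , S∈blocks) = ∈-concat⁻′ (map A (upTo (suc p))) m∈blocks
        (n , _ , S≡An)       = ∈-map⁻ A S∈blocks
    in n , subst (m ∈_) S≡An m∈S
    where
    in-prefix : IsRecordAt (nth (Ypre A (suc p))) p m
    in-prefix = IsRecordAt-agree (λ q q≤p → Y-agrees (suc p) (≤-trans (s≤s q≤p) (≤-length-Ypre _))) isRecord
    m∈blocks : m ∈ concat (map A (upTo (suc p)))
    m∈blocks = uA-record∈ _ 1≤m (subst (λ w → IsRecordAt (nth w) p m) (concat-map-uA A (upTo (suc p))) in-prefix)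

  suffix⇒eventually-covered : IsSuffixOfZ (Y A) → ∃[ M ] ∀ x → M ≤ x → ∃[ n ] x ∈ A n
  suffix⇒eventually-covered (k , Y≡Z) = suc k , covered
    where
    covered : ∀ x → suc k ≤ x → ∃[ n ] x ∈ A n
    covered (suc m) (s≤s k≤m) = Y-record∈block (s≤s z≤n)
      (IsRecordAt-agree (λ q _ → sym (Y≡Z q)) (IsRecordAt-shift k (subst (λ q → IsRecordAt Z q (suc m))
        (sym (m+[n∸m]≡n (≤-trans k≤m (≤-length-zimin m)))) (Z-record m))))

  block-< : ∀ {i j x y} → i < j → x ∈ A i → y ∈ A j → x < y
  block-< {i} {suc j} (s≤s i≤j) x∈ y∈ with m≤n⇒m<n∨m≡n i≤j
  ... | inj₂ refl = ordered i _ _ x∈ y∈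
  ... | inj₁ i<j  = <-trans (block-< i<j x∈ (maxL-∈ (nonempty j))) (ordered j _ _ (maxL-∈ (nonempty j)) y∈)

  block-index : ∀ {j n x} → x ∈ A j → minL (A n) ≤ x → x ≤ maxL (A n) → j ≡ n
  block-index {j} {n} x∈ min≤x x≤max with <-cmp j n
  ... | tri< j<n _ _ = ⊥-elim (<⇒≱ (block-< j<n x∈ (minL-∈ (nonempty n))) min≤x)
  ... | tri≈ _ j≡n _ = j≡n
  ... | tri> _ _ n<j = ⊥-elim (<⇒≱ (block-< n<j (maxL-∈ (nonempty n)) x∈) x≤max)

  minL-≤-later : ∀ {j n x} → n ≤ j → x ∈ A j → minL (A n) ≤ x
  minL-≤-later n≤j x∈ with m≤n⇒m<n∨m≡n n≤j
  ... | inj₁ n<j  = <⇒≤ (block-< n<j (minL-∈ (nonempty _)) x∈)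
  ... | inj₂ refl = minL-lb x∈

  ≤-maxL-earlier : ∀ {j n x} → j ≤ n → x ∈ A j → x ≤ maxL (A n)
  ≤-maxL-earlier j≤n x∈ with m≤n⇒m<n∨m≡n j≤n
  ... | inj₁ j<n  = <⇒≤ (block-< j<n x∈ (maxL-∈ (nonempty _)))
  ... | inj₂ refl = maxL-ub x∈

  eventually-covered⇒eventually-consecutive-intervals :
    ∀ M → (∀ x → M ≤ x → ∃[ n ] x ∈ A n) →
    ∃[ N ] ∀ n → N ≤ n → IsInterval (A n) × minL (A (suc n)) ≡ suc (maxL (A n))
  eventually-covered⇒eventually-consecutive-intervals M cover with cover M ≤-refl
  ... | n₀ , M∈ = suc n₀ , λ n n₀<n → interval n₀<n , consecutive n₀<n
    where
    covered : ∀ {n} → n₀ < n → ∀ x → minL (A n) ≤ x → ∃[ j ] x ∈ A j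
    covered n₀<n x min≤x = cover x (≤-trans (<⇒≤ (block-< n₀<n M∈ (minL-∈ (nonempty _)))) min≤x)
    interval : ∀ {n} → n₀ < n → IsInterval (A n)
    interval {n} n₀<n = minL (A n) , maxL (A n) , λ x → mk⇔ (λ x∈ → minL-lb x∈ , maxL-ub x∈) λ (min≤x , x≤max) →
      let (j , x∈) = covered n₀<n x min≤x in subst (λ j → x ∈ A j) (block-index x∈ min≤x x≤max) x∈
    consecutive : ∀ {n} → n₀ < n → minL (A (suc n)) ≡ suc (maxL (A n))
    consecutive {n} n₀<n with covered n₀<n (suc (maxL (A n))) (m≤n⇒m≤1+n (minL≤maxL (nonempty n)))
    ... | j , y∈ with j ≤? n
    ...   | yes j≤n = ⊥-elim (<-irrefl refl (≤-maxL-earlier j≤n y∈))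
    ...   | no  j≰n = ≤-antisym (minL-≤-later (≰⇒> j≰n) y∈)
                        (ordered n _ _ (maxL-∈ (nonempty n)) (minL-∈ (nonempty (suc n))))

  before : ℕ → ℕ
  before zero    = 0
  before (suc n) = maxL (A n)

  before-< : ∀ n {x} → x ∈ A n → before n < x
  before-< zero    x∈ = All.lookup (positive 0) x∈
  before-< (suc n) x∈ = ordered n _ _ (maxL-∈ (nonempty n)) x∈

  Ypre-suffix : (∀ n → AllPairs _<_ (A n)) → ∀ n → Ypre A n IsSuffixOf zimin (before n)
  Ypre-suffix sorted zero    = [] , refl
  Ypre-suffix sorted (suc n) = subst (_IsSuffixOf zimin (maxL (A n))) (sym (Ypre-suc A n))
    (zimin-extend (A n) (Ypre-suffix sorted n) (All.tabulate (before-< n)) (sorted n) (All.tabulate maxL-ub)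
      (<⇒≤ (before-< n (maxL-∈ (nonempty n)))))

  eventually-consecutive-intervals⇒suffix : (∀ n → AllPairs _<_ (A n)) →
    ∃[ N ] (∀ n → N ≤ n → IsInterval (A n) × minL (A (suc n)) ≡ suc (maxL (A n))) → IsSuffixOfZ (Y A)
  eventually-consecutive-intervals⇒suffix sorted (N , consecutive) = length R , Y≡Z
    where
    open ≡-Reasoning
    R = proj₁ (Ypre-suffix sorted (suc N))
    telescope : ∀ n → N ≤ n → zimin (maxL (A n)) ≡ R ++ Ypre A (suc n)
    telescope n N≤n with m≤n⇒m<n∨m≡n N≤n
    telescope n       _ | inj₂ refl      = proj₂ (Ypre-suffix sorted (suc N))
    telescope zero    _ | inj₁ ()
    telescope (suc n) _ | inj₁ (s≤s N≤n) = begin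
      zimin (maxL (A (suc n)))                 ≡⟨ zimin-interval (nonempty (suc n)) (sorted (suc n))
                                                    (proj₁ (consecutive (suc n) (m≤n⇒m≤1+n N≤n))) (proj₂ (consecutive n N≤n)) ⟩
      zimin (maxL (A n)) ++ uA (A (suc n))     ≡⟨ cong (_++ uA (A (suc n))) (telescope n N≤n) ⟩
      (R ++ Ypre A (suc n)) ++ uA (A (suc n))  ≡⟨ ++-assoc R _ _ ⟩
      R ++ (Ypre A (suc n) ++ uA (A (suc n)))  ≡⟨ cong (R ++_) (Ypre-suc A (suc n)) ⟨
      R ++ Ypre A (suc (suc n))                ∎
    Y≡Z : ∀ i → Y A i ≡ Z (length R + i)
    Y≡Z i = begin
      Y A i                                    ≡⟨ Y-agrees (suc n) i<len ⟩
      nth (Ypre A (suc n)) i                   ≡⟨ nth-++ʳ R _ i ⟨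
      nth (R ++ Ypre A (suc n)) (length R + i) ≡⟨ cong (λ w → nth w (length R + i)) (telescope n N≤n) ⟨
      nth (zimin (maxL (A n))) (length R + i)  ≡⟨ Z-agrees (maxL (A n)) p<len ⟨
      Z (length R + i)                         ∎
      where
      n = N + i
      N≤n = m≤m+n N i
      i<len : i < length (Ypre A (suc n))
      i<len = ≤-trans (s≤s (m≤n+m i N)) (≤-length-Ypre (suc n))
      p<len : length R + i < length (zimin (maxL (A n)))
      p<len = subst (λ w → length R + i < length w) (sym (telescope n N≤n))
                (subst (length R + i <_) (sym (length-++ R)) (+-monoʳ-< (length R) i<len))

-- the sequence A_1, A_2, ... is indexed from 0 here: A 0 = A_1
lemma1 : (A : ℕ → List ℕ)
           → (∀ n → A n ≢ [])
           → (∀ n → All (1 ≤_) (A n))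
           → (∀ n → Linked _<_ (A n))
           → (∀ n x y → x ∈ A n → y ∈ A (suc n) → x < y)
           → IsSuffixOfZ (Y A)
             ⇔ (∃[ N ] ∀ n → N ≤ n → IsInterval (A n) × minL (A (suc n)) ≡ suc (maxL (A n)))
lemma1 A nonempty positive linked ordered = mk⇔
  (λ Y-suffix → let (M , covered) = suffix⇒eventually-covered Y-suffix
                in eventually-covered⇒eventually-consecutive-intervals M covered)
  (eventually-consecutive-intervals⇒suffix (λ n → Linked⇒AllPairs <-trans (linked n)))
  where open Blocks A nonempty positive ordered
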